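{- For every Euler–Venn diagram $d$ and all multisets $\Gamma,\Delta$ of compound diagrams, the following rules are sound (validity of all premisses implies validity of the conclusion): (DetL) from $d,\Gamma\Rightarrow \mathrm{euler}(d)$ and $\mathrm{venn}(d),\Gamma\Rightarrow\Delta$ infer $d,\Gamma\Rightarrow\Delta$; (DetR) from $\mathrm{euler}(d),\Gamma\Rightarrow\mathrm{venn}(d)$ infer $\Gamma\Rightarrow\Delta,d$.
   Context: Fix a countable set $\mathcal V$ of propositional variables (contours). A Heyting algebra $(H,\vee,\wedge,\to,0,1)$ is a bounded distributive lattice with relative pseudo-complement $\to$ ($c\wedge a\le b$ iff $c\le a\to b$); $-a:=a\to0$; empty meets are $1$, empty joins $0$. A valuation is a map $v:\mathcal V\to H$. A zone for finite $L\subset\mathcal V$ is a pair $z=(z^{in},z^{out})$ of disjoint subsets of $L$ with union $L$; $\mathcal Z(L)$ is the set of all zones. $v(z)=\bigwedge_{c\in z^{in}}v(c)\wedge\bigwedge_{c\in z^{out}}-v(c)$; $m_v(z)=\bigwedge_{c\in z^{in}}v(c)\to\bigvee_{c\in z^{out}}v(c)$. A Venn diagram $(L,\mathcal Z(L),S)$, $S\subseteq \mathcal Z(L)$, has semantics $\bigvee_{z\in S}v(z)$. A pure Euler diagram $(L,Z)$, $Z\subseteq\mathcal Z(L)$, has semantics $\bigwedge_{z\in\mathcal Z(L)\setminus Z}m_v(z)$. An Euler–Venn diagram is $d=(L,Z,S)$ with $Z\subseteq\mathcal Z(L)$ and $S\subseteq Z$; $\mathrm{venn}(d)=(L,\mathcal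 Z(L),S)$, $\mathrm{euler}(d)=(L,Z)$, and $v(d)=v(\mathrm{euler}(d))\to v(\mathrm{venn}(d))$. Compound diagrams: $D::=d\mid D\wedge D\mid D\vee D\mid D\to D$ with unitary $d$ and Heyting operations as semantics. A sequent $\Gamma\Rightarrow\Delta$ consists of finite multisets of compound diagrams; it is valid iff $\bigwedge_{D\in\Gamma}v(D)\le\bigvee_{E\in\Delta}v(E)$ for every valuation in every Heyting algebra. -}

module Defs where

open import Level using (Level)
open import Data.Bool using (Bool; true; false; if_then_else_)
open import Data.Nat using (ℕ; zero; suc)
open import Data.List using (List; []; _∷_; length; map; foldr; filter)
open import Data.List.Relation.Unary.Unique.Propositional using (Unique)
open import Data.Vec using (Vec; []; _∷_)
open import Data.Product using (_×_; _,_)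
open import Relation.Binary.PropositionalEquality using (_≡_)
open import Relation.Binary.Lattice.Bundles using (HeytingAlgebra)

Contour : Set
Contour = ℕ

-- A finite set L ⊂ 𝒱 is a duplicate-free list.
-- A zone for L assigns to each contour of L (by position) whether it is
-- in z^in (true) or in z^out (false); this is exactly a partition of L
-- into two disjoint sets with union L.
Zone : List Contour → Set
Zone L = Vec Bool (length L)

zin : (L : List Contour) → Zone L → List Contour
zin [] [] = []
zin (c ∷ L) (true ∷ z) = c ∷ zin L z
zin (c ∷ L) (false ∷ z) = zin L z

zout : (L : List Contour) → Zone L → List Contour
zout [] [] = []
zout (c ∷ L) (true ∷ z) = zout L z
zout (c ∷ L) (false ∷ z) = c ∷ zout L z

allVecs : (n : ℕ) → List (Vec Bool n)
allVecs zero = [] ∷ []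
allVecs (suc n) = Data.List._++_ (map (true ∷_) (allVecs n)) (map (false ∷_) (allVecs n))

allZones : (L : List Contour) → List (Zone L)
allZones L = allVecs (length L)

-- A set of zones Z ⊆ 𝒵(L) (𝒵(L) is finite, so a Boolean predicate).
ZoneSet : List Contour → Set
ZoneSet L = Zone L → Bool

record EVDiagram : Set where
  field
    L    : List Contour
    uniq : Unique L
    Z    : ZoneSet L
    S    : ZoneSet L
    S⊆Z  : ∀ z → S z ≡ true → Z z ≡ true

data Unitary : Set where
  venn  : (L : List Contour) → Unique L → ZoneSet L → Unitary
  euler : (L : List Contour) → Unique L → ZoneSet L → Unitary
  ev    : EVDiagram → Unitary

infixr 6 _∧ᵈ_ _∨ᵈ_
infixr 5 _→ᵈ_
data Diagram : Set where
  unit : Unitary → Diagram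
  _∧ᵈ_ : Diagram → Diagram → Diagram
  _∨ᵈ_ : Diagram → Diagram → Diagram
  _→ᵈ_ : Diagram → Diagram → Diagram

vennOf : EVDiagram → Diagram
vennOf d = unit (venn (EVDiagram.L d) (EVDiagram.uniq d) (EVDiagram.S d))

eulerOf : EVDiagram → Diagram
eulerOf d = unit (euler (EVDiagram.L d) (EVDiagram.uniq d) (EVDiagram.Z d))

evOf : EVDiagram → Diagram
evOf d = unit (ev d)

module Semantics {c ℓ₁ ℓ₂ : Level} (H : HeytingAlgebra c ℓ₁ ℓ₂) where
  open HeytingAlgebra H

  Valuation : Set c
  Valuation = Contour → Carrier

  ⋀ : List Carrier → Carrier
  ⋀ = foldr _∧_ ⊤

  ⋁ : List Carrier → Carrier
  ⋁ = foldr _∨_ ⊥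

  -_ : Carrier → Carrier
  - a = a ⇨ ⊥

  module _ (v : Valuation) where
    zoneVal : (L : List Contour) → Zone L → Carrier
    zoneVal L z = ⋀ (map v (zin L z)) ∧ ⋀ (map (λ x → - v x) (zout L z))

    missing : (L : List Contour) → Zone L → Carrier
    missing L z = ⋀ (map v (zin L z)) ⇨ ⋁ (map v (zout L z))

    vennVal : (L : List Contour) → ZoneSet L → Carrier
    vennVal L S = ⋁ (map (zoneVal L) (filter (λ z → Data.Bool.T? (S z)) (allZones L)))

    eulerVal : (L : List Contour) → ZoneSet L → Carrier
    eulerVal L Z = ⋀ (map (missing L) (filter (λ z → Data.Bool.T? (Data.Bool.not (Z z))) (allZones L)))

    unitVal : Unitary → Carrier
    unitVal (venn L _ S) = vennVal L S
    unitVal (euler L _ Z) = eulerVal L Z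
    unitVal (ev d) = eulerVal (EVDiagram.L d) (EVDiagram.Z d) ⇨ vennVal (EVDiagram.L d) (EVDiagram.S d)

    ⟦_⟧ : Diagram → Carrier
    ⟦ unit u ⟧ = unitVal u
    ⟦ D ∧ᵈ E ⟧ = ⟦ D ⟧ ∧ ⟦ E ⟧
    ⟦ D ∨ᵈ E ⟧ = ⟦ D ⟧ ∨ ⟦ E ⟧
    ⟦ D →ᵈ E ⟧ = ⟦ D ⟧ ⇨ ⟦ E ⟧

-- Validity of a sequent Γ ⇒ Δ (multisets as lists; order is irrelevant to
-- the semantics) over all Heyting algebras at universe levels c ℓ₁ ℓ₂.
Valid : (c ℓ₁ ℓ₂ : Level) → List Diagram → List Diagram → Set (Level.suc (c Level.⊔ ℓ₁ Level.⊔ ℓ₂))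
Valid c ℓ₁ ℓ₂ Γ Δ =
  (H : HeytingAlgebra c ℓ₁ ℓ₂) (v : Contour → HeytingAlgebra.Carrier H) →
  let open Semantics H in
  HeytingAlgebra._≤_ H (⋀ (map (⟦_⟧ v) Γ)) (⋁ (map (⟦_⟧ v) Δ))

-- In a Heyting algebra the semantics of d is e ⇨ w with e = euler(d) and
-- w = venn(d).  (DetL) is a cut: if (e ⇨ w) ∧ g ≤ e then modus ponens yields
-- w, and the second premiss takes over.  (DetR) is ⇨-introduction: e ∧ g ≤ w
-- transposes to g ≤ e ⇨ w, and the right-hand side of a sequent is a join.
module Submission where

open import Defs
open import Level using (Level)
open import Data.List using (List; []; _∷_; _++_; map)
open import Data.Product using (_×_; _,_)
open import Relation.Binary.Lattice.Bundles using (HeytingAlgebra)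

module _ {c ℓ₁ ℓ₂ : Level} (H : HeytingAlgebra c ℓ₁ ℓ₂) where
  open HeytingAlgebra H
  open Semantics H using (⋁)
  open import Relation.Binary.Lattice.Properties.HeytingAlgebra H using (⇨-eval)
  open import Relation.Binary.Lattice.Properties.BoundedJoinSemilattice boundedJoinSemilattice
    using (identityʳ)

  ⋁-singleton-≤ : ∀ x → ⋁ (x ∷ []) ≤ x
  ⋁-singleton-≤ x = reflexive (identityʳ x)

  ≤-⋁-map-snoc : ∀ {a} {A : Set a} (f : A → Carrier) x xs →
                 f x ≤ ⋁ (map f (xs ++ x ∷ []))
  ≤-⋁-map-snoc f x []       = x≤x∨y (f x) ⊥
  ≤-⋁-map-snoc f x (y ∷ xs) = trans (≤-⋁-map-snoc f x xs) (y≤x∨y (f y) _)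

  ⇨-cut : ∀ {a b g r : Carrier} → (a ⇨ b) ∧ g ≤ a → b ∧ g ≤ r → (a ⇨ b) ∧ g ≤ r
  ⇨-cut {a} {b} {g} p q = trans (∧-greatest modusPonens (x∧y≤y _ _)) q
    where
    modusPonens : (a ⇨ b) ∧ g ≤ b
    modusPonens = trans (∧-greatest (x∧y≤x _ _) p) ⇨-eval

lemma9 : {c ℓ₁ ℓ₂ : Level} (d : EVDiagram) (Γ Δ : List Diagram) →
    -- (DetL)
    (Valid c ℓ₁ ℓ₂ (evOf d ∷ Γ) (eulerOf d ∷ []) →
     Valid c ℓ₁ ℓ₂ (vennOf d ∷ Γ) Δ →
     Valid c ℓ₁ ℓ₂ (evOf d ∷ Γ) Δ)
    ×
    -- (DetR)
    (Valid c ℓ₁ ℓ₂ (eulerOf d ∷ Γ) (vennOf d ∷ []) →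
     Valid c ℓ₁ ℓ₂ Γ (Δ ++ (evOf d ∷ [])))
lemma9 d Γ Δ = detL , detR
  where
  detL : ∀ {c ℓ₁ ℓ₂} → Valid c ℓ₁ ℓ₂ (evOf d ∷ Γ) (eulerOf d ∷ []) →
         Valid c ℓ₁ ℓ₂ (vennOf d ∷ Γ) Δ → Valid c ℓ₁ ℓ₂ (evOf d ∷ Γ) Δ
  detL toEuler fromVenn H v =
    ⇨-cut H (trans (toEuler H v) (⋁-singleton-≤ H _)) (fromVenn H v)
    where open HeytingAlgebra H using (trans)

  detR : ∀ {c ℓ₁ ℓ₂} → Valid c ℓ₁ ℓ₂ (eulerOf d ∷ Γ) (vennOf d ∷ []) →
         Valid c ℓ₁ ℓ₂ Γ (Δ ++ (evOf d ∷ []))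
  detR eulerToVenn H v =
    trans (swap-transpose-⇨ (trans (eulerToVenn H v) (⋁-singleton-≤ H _)))
          (≤-⋁-map-snoc H (Semantics.⟦_⟧ H v) (evOf d) Δ)
    where
    open HeytingAlgebra H using (trans)
    open import Relation.Binary.Lattice.Properties.HeytingAlgebra H using (swap-transpose-⇨)
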